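{- For every integer $n\geq 2$, $\gamma_t(C(K_n))=n+\lceil n/2\rceil -1$, where $K_n$ is the complete graph on $n$ vertices.
   Context: For a graph $G=(V,E)$ with $V=\{v_1,\dots,v_n\}$, the central graph $C(G)$ is the graph with vertex set $V\cup\{c_{ij} : v_iv_j\in E\}$ obtained by subdividing each edge $v_iv_j$ of $G$ exactly once by a new vertex $c_{ij}$ (adjacent to exactly $v_i$ and $v_j$) and joining every pair of distinct vertices non-adjacent in $G$. A total dominating set of a graph $H$ is a set $S\subseteq V(H)$ such that every vertex of $H$ has a neighbor in $S$; $\gamma_t(H)$ is the minimum cardinality of a total dominating set of $H$. -}

module Defs where

open import Data.Nat using (ℕ; _≥_)
open import Data.Fin using (Fin; _<_; _≟_)
open import Data.Bool using (Bool; true; false; T; not)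
open import Data.Product using (Σ; _×_; _,_; ∃)
open import Data.Sum using (_⊎_; inj₁; inj₂)
open import Data.Empty using (⊥; ⊥-elim)
open import Relation.Nullary using (yes; no)
open import Data.List using (List; length)
open import Data.List.Membership.Propositional using (_∈_)
open import Data.List.Relation.Unary.Unique.Propositional using (Unique)
open import Relation.Binary.PropositionalEquality using (_≡_; _≢_; refl; sym)
open import Relation.Nullary.Decidable using (⌊_⌋)

record SimpleGraph (n : ℕ) : Set where
  field
    adj   : Fin n → Fin n → Bool
    adj-sym : ∀ i j → adj i j ≡ adj j i
    adj-irrefl : ∀ i → adj i i ≡ false

open SimpleGraph public

complete : (n : ℕ) → SimpleGraph n
complete n = record
  { adj = λ i j → not ⌊ i ≟ j ⌋
  ; adj-sym = symP
  ; adj-irrefl = irr }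
  where
  symP : ∀ i j → not ⌊ i ≟ j ⌋ ≡ not ⌊ j ≟ i ⌋
  symP i j with i ≟ j | j ≟ i
  ... | yes _ | yes _ = refl
  ... | no _  | no _  = refl
  ... | yes p | no q  = ⊥-elim (q (sym p))
  ... | no p  | yes q = ⊥-elim (p (sym q))
  irr : ∀ i → not ⌊ i ≟ i ⌋ ≡ false
  irr i with i ≟ i
  ... | yes _ = refl
  ... | no ¬p = ⊥-elim (¬p refl)

record Graph : Set₁ where
  field
    Vertex : Set
    Adj    : Vertex → Vertex → Set

open Graph public

-- Edges of G as ordered pairs (i , j) with i < j and i ~ j;
-- each edge {v_i , v_j} of G is represented exactly once.
Edge : ∀ {n} → SimpleGraph n → Set
Edge {n} G = Σ (Fin n × Fin n) λ { (i , j) → (i < j) × T (adj G i j) }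

-- Vertex set of the central graph: original vertices and
-- one subdivision vertex c_ij per edge v_i v_j of G.
CVertex : ∀ {n} → SimpleGraph n → Set
CVertex {n} G = Fin n ⊎ Edge G

CAdj : ∀ {n} (G : SimpleGraph n) → CVertex G → CVertex G → Set
CAdj G (inj₁ i) (inj₁ j) = (i ≢ j) × T (not (adj G i j))
CAdj G (inj₁ k) (inj₂ ((i , j) , _)) = (k ≡ i) ⊎ (k ≡ j)
CAdj G (inj₂ ((i , j) , _)) (inj₁ k) = (k ≡ i) ⊎ (k ≡ j)
CAdj G (inj₂ _) (inj₂ _) = ⊥

central : ∀ {n} → SimpleGraph n → Graph
central G = record { Vertex = CVertex G ; Adj = CAdj G }

IsTotalDominating : (H : Graph) → List (Vertex H) → Set
IsTotalDominating H S = ∀ v → ∃ λ u → (u ∈ S) × Adj H v u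

TotalDominationNumber : Graph → ℕ → Set
TotalDominationNumber H k =
  (∃ λ S → Unique S × IsTotalDominating H S × length S ≡ k) ×
  (∀ S → Unique S → IsTotalDominating H S → length S ≥ k)

-- Let S be a total dominating set of C(K_n). A subdivision vertex c_ij has
-- only v_i and v_j as neighbours, so the original vertices in S form a vertex
-- cover of K_n and number at least n - 1. The original vertices are pairwise
-- non-adjacent in C(K_n), so each v_k is dominated by a subdivision vertex in
-- S; these form an edge cover of K_n, hence number at least ⌈n/2⌉. Conversely,
-- v_1, …, v_{n-1} together with the ⌈n/2⌉ subdivision vertices of the edges
-- v_k v_{k+⌊n/2⌋} (k < ⌈n/2⌉) form a total dominating set.
module Submission where

open import Defs
open import Data.Nat using (ℕ; zero; suc; _+_; _∸_; _≥_; _/_; _≤_; z≤n; s≤s; z<s; ⌊_/2⌋; ⌈_/2⌉)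
import Data.Nat as ℕ
open import Data.Nat.Properties
open import Data.Nat.DivMod using (m/n≡1+[m∸n]/n)
open import Data.Fin as Fin using (Fin; toℕ; fromℕ<; punchIn)
import Data.Fin.Properties as Fin
open import Data.Bool using (T; not)
open import Data.Bool.Properties using (not-involutive)
open import Data.Product using (_×_; _,_; ∃; proj₁; proj₂)
open import Data.Sum using (_⊎_; inj₁; inj₂; [_,_]′)
open import Data.Sum.Properties using (inj₁-injective; inj₂-injective)
open import Data.Empty using (⊥-elim)
open import Data.List using (List; []; _∷_; length; _++_; tabulate)
open import Data.List.Properties using (length-++; length-tabulate)
open import Data.List.Membership.Propositional using (_∈_)
open import Data.List.Membership.Propositional.Properties using (∈-tabulate⁺; ∈-tabulate⁻; ∈-++⁺ˡ; ∈-++⁺ʳ)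
import Data.List.Membership.DecPropositional as DecMembership
open import Data.List.Membership.Setoid.Properties using (index-injective)
open import Data.List.Relation.Unary.Any using (here; there; index)
open import Data.List.Relation.Unary.Unique.Propositional using (Unique)
import Data.List.Relation.Unary.Unique.Propositional.Properties as Unique
open import Function using (id; _∘_; Injective)
open import Relation.Binary.PropositionalEquality
open import Relation.Binary.Definitions using (tri<; tri≈; tri>)
open import Relation.Nullary using (yes; no; ¬_)
open import Relation.Nullary.Decidable using (⌊_⌋; toWitness; fromWitnessFalse)

⌊n/2⌋≡n/2 : ∀ n → ⌊ n /2⌋ ≡ n / 2
⌊n/2⌋≡n/2 zero = refl
⌊n/2⌋≡n/2 (suc zero) = refl
⌊n/2⌋≡n/2 (suc (suc n)) =
  trans (cong suc (⌊n/2⌋≡n/2 n)) (sym (m/n≡1+[m∸n]/n {suc (suc n)} {2} (s≤s (s≤s z≤n))))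

⌈n/2⌉≡[n+1]/2 : ∀ n → ⌈ n /2⌉ ≡ (n + 1) / 2
⌈n/2⌉≡[n+1]/2 n = trans (⌊n/2⌋≡n/2 (suc n)) (cong (_/ 2) (+-comm 1 n))

⌈n+n/2⌉≡n : ∀ n → ⌈ n + n /2⌉ ≡ n
⌈n+n/2⌉≡n zero = refl
⌈n+n/2⌉≡n (suc n) = cong suc (trans (cong ⌊_/2⌋ (+-suc n n)) (⌈n+n/2⌉≡n n))

injective⇒≤length : ∀ {A : Set} {k} {ys : List A} (f : Fin k → A) →
  Injective _≡_ _≡_ f → (∀ i → f i ∈ ys) → k ≤ length ys
injective⇒≤length {A} f f-inj f∈ys = Fin.injective⇒≤ {f = index ∘ f∈ys}
  (λ {i} {j} eq → f-inj (index-injective (setoid A) (f∈ys i) (f∈ys j) eq))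

module _ {m} {xs : List (Fin (suc m))} where

  open DecMembership (Fin._≟_ {suc m}) using (_∈?_)

  allBut⇒≤length : ∀ z → (∀ i → i ≢ z → i ∈ xs) → m ≤ length xs
  allBut⇒≤length z all-but-z = injective⇒≤length (punchIn z)
    (Fin.punchIn-injective z _ _) (λ i → all-but-z (punchIn z i) (Fin.punchInᵢ≢i z i))

  vertexCover⇒≤length : (∀ {i j} → i ≢ j → i ∈ xs ⊎ j ∈ xs) → m ≤ length xs
  vertexCover⇒≤length cover with Fin.all? (_∈? xs)
  ... | yes all-in = allBut⇒≤length Fin.zero (λ i _ → all-in i)
  ... | no ¬all-in with Fin.¬∀⟶∃¬ (suc m) (_∈ xs) (_∈? xs) ¬all-in
  ...   | z , z∉xs = allBut⇒≤length z (λ i i≢z → [ id , ⊥-elim ∘ z∉xs ]′ (cover i≢z))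

module _ {A B : Set} where

  lefts : List (A ⊎ B) → List A
  lefts [] = []
  lefts (inj₁ a ∷ s) = a ∷ lefts s
  lefts (inj₂ _ ∷ s) = lefts s

  rights : List (A ⊎ B) → List B
  rights [] = []
  rights (inj₁ _ ∷ s) = rights s
  rights (inj₂ b ∷ s) = b ∷ rights s

  length-lefts+rights : ∀ s → length (lefts s) + length (rights s) ≡ length s
  length-lefts+rights [] = refl
  length-lefts+rights (inj₁ a ∷ s) = cong suc (length-lefts+rights s)
  length-lefts+rights (inj₂ b ∷ s) =
    trans (+-suc (length (lefts s)) _) (cong suc (length-lefts+rights s))

  ∈-lefts : ∀ {a} s → inj₁ a ∈ s → a ∈ lefts s
  ∈-lefts (inj₁ _ ∷ s) (here refl) = here refl
  ∈-lefts (inj₁ _ ∷ s) (there p) = there (∈-lefts s p)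
  ∈-lefts (inj₂ _ ∷ s) (there p) = ∈-lefts s p

  ∈-rights : ∀ {b} s → inj₂ b ∈ s → b ∈ rights s
  ∈-rights (inj₂ _ ∷ s) (here refl) = here refl
  ∈-rights (inj₂ _ ∷ s) (there p) = there (∈-rights s p)
  ∈-rights (inj₁ _ ∷ s) (there p) = ∈-rights s p

module _ {n} {G : SimpleGraph n} where

  endpoints : List (Edge G) → List (Fin n)
  endpoints [] = []
  endpoints (((i , j) , _) ∷ es) = i ∷ j ∷ endpoints es

  length-endpoints : ∀ es → length (endpoints es) ≡ length es + length es
  length-endpoints [] = refl
  length-endpoints (_ ∷ es) =
    cong suc (trans (cong suc (length-endpoints es)) (sym (+-suc (length es) (length es))))

  ∈-endpoints : ∀ es {i j p} → ((i , j) , p) ∈ es → i ∈ endpoints es × j ∈ endpoints es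
  ∈-endpoints (_ ∷ es) (here refl) = here refl , there (here refl)
  ∈-endpoints (_ ∷ es) (there q) =
    let i∈ , j∈ = ∈-endpoints es q in there (there i∈) , there (there j∈)

  edgeCover⇒≤length : ∀ es → (∀ v → v ∈ endpoints es) → n ≤ length es + length es
  edgeCover⇒≤length es cover =
    subst (n ≤_) (length-endpoints es) (injective⇒≤length id id cover)

  totalDominating⇒vertexCover : ∀ {S} → IsTotalDominating (central G) S →
    ∀ {i j} → i Fin.< j → T (adj G i j) → i ∈ lefts S ⊎ j ∈ lefts S
  totalDominating⇒vertexCover {S} dom i<j ij with dom (inj₂ (_ , i<j , ij))
  ... | inj₁ _ , k∈S , inj₁ refl = inj₁ (∈-lefts S k∈S)
  ... | inj₁ _ , k∈S , inj₂ refl = inj₂ (∈-lefts S k∈S)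

completeEdge : ∀ {n} {i j : Fin n} → i Fin.< j → Edge (complete n)
completeEdge i<j = _ , i<j , fromWitnessFalse (Fin.<⇒≢ i<j)

complete-originals-nonadjacent : ∀ {n} (i j : Fin n) → ¬ CAdj (complete n) (inj₁ i) (inj₁ j)
complete-originals-nonadjacent i j (i≢j , ¬¬i≡j) =
  i≢j (toWitness (subst T (not-involutive ⌊ i Fin.≟ j ⌋) ¬¬i≡j))

module _ {n} {S : List (CVertex (complete n))} (dom : IsTotalDominating (central (complete n)) S) where

  complete-originalsCover : ∀ {i j} → i ≢ j → i ∈ lefts S ⊎ j ∈ lefts S
  complete-originalsCover {i} {j} i≢j with Fin.<-cmp i j
  ... | tri< i<j _ _ = totalDominating⇒vertexCover dom i<j (fromWitnessFalse (Fin.<⇒≢ i<j))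
  ... | tri≈ _ i≡j _ = ⊥-elim (i≢j i≡j)
  ... | tri> _ _ j<i = [ inj₂ , inj₁ ]′
          (totalDominating⇒vertexCover dom j<i (fromWitnessFalse (Fin.<⇒≢ j<i)))

  complete-subdivisionsCover : ∀ v → v ∈ endpoints {G = complete n} (rights S)
  complete-subdivisionsCover v with dom (inj₁ v)
  ... | inj₁ u , _ , v~u = ⊥-elim (complete-originals-nonadjacent v u v~u)
  ... | inj₂ _ , e∈S , inj₁ refl = proj₁ (∈-endpoints {G = complete n} (rights S) (∈-rights S e∈S))
  ... | inj₂ _ , e∈S , inj₂ refl = proj₂ (∈-endpoints {G = complete n} (rights S) (∈-rights S e∈S))

totalDominating-central-complete-≥ : ∀ m (S : List (CVertex (complete (suc m)))) →
  IsTotalDominating (central (complete (suc m))) S → m + ⌈ suc m /2⌉ ≤ length S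
totalDominating-central-complete-≥ m S dom = begin
  m + ⌈ suc m /2⌉                        ≤⟨ +-mono-≤ originals subdivisions ⟩
  length (lefts S) + length (rights S)   ≡⟨ length-lefts+rights S ⟩
  length S                               ∎
  where
  open ≤-Reasoning
  r = length (rights S)
  originals : m ≤ length (lefts S)
  originals = vertexCover⇒≤length (complete-originalsCover dom)
  subdivisions : ⌈ suc m /2⌉ ≤ r
  subdivisions = subst (⌈ suc m /2⌉ ≤_) (⌈n+n/2⌉≡n r)
    (⌈n/2⌉-mono (edgeCover⇒≤length {G = complete (suc m)} (rights S) (complete-subdivisionsCover dom)))

module ShiftedMatching (m h f : ℕ) (0<f : 0 ℕ.< f) (h+f≡n : h + f ≡ suc m) (f≤h : f ≤ h) where

  n = suc m

  lower upper : Fin h → Fin n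
  lower k = fromℕ< (≤-trans (Fin.toℕ<n k) (subst (h ≤_) h+f≡n (m≤m+n h f)))
  upper k = fromℕ< (subst (toℕ k + f ℕ.<_) h+f≡n (+-monoˡ-< f (Fin.toℕ<n k)))

  toℕ-lower : ∀ k → toℕ (lower k) ≡ toℕ k
  toℕ-lower k = Fin.toℕ-fromℕ< _

  toℕ-upper : ∀ k → toℕ (upper k) ≡ toℕ k + f
  toℕ-upper k = Fin.toℕ-fromℕ< _

  lower<upper : ∀ k → lower k Fin.< upper k
  lower<upper k = subst₂ ℕ._<_ (sym (toℕ-lower k)) (sym (toℕ-upper k)) (m<m+n (toℕ k) 0<f)

  edge : Fin h → Edge (complete n)
  edge k = completeEdge (lower<upper k)

  edge-injective : Injective _≡_ _≡_ edge
  edge-injective {k} {k′} eq = Fin.toℕ-injective (begin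
    toℕ k                            ≡⟨ toℕ-lower k ⟨
    toℕ (lower k)                    ≡⟨ cong (toℕ ∘ proj₁ ∘ proj₁) eq ⟩
    toℕ (lower k′)                   ≡⟨ toℕ-lower k′ ⟩
    toℕ k′                           ∎)
    where open ≡-Reasoning

  edges-cover : ∀ w → ∃ λ k → w ≡ lower k ⊎ w ≡ upper k
  edges-cover w with toℕ w ℕ.<? h
  ... | yes w<h = fromℕ< w<h ,
        inj₁ (Fin.toℕ-injective (sym (trans (toℕ-lower _) (Fin.toℕ-fromℕ< w<h))))
  ... | no w≮h = fromℕ< w∸f<h ,
        inj₂ (Fin.toℕ-injective (sym (trans (toℕ-upper _) w∸f+f≡w)))
    where
    f≤w : f ≤ toℕ w
    f≤w = ≤-trans f≤h (≮⇒≥ w≮h)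
    w∸f<h : toℕ w ∸ f ℕ.< h
    w∸f<h = subst (toℕ w ∸ f ℕ.<_) (m+n∸n≡m h f)
      (∸-monoˡ-< (subst (toℕ w ℕ.<_) (sym h+f≡n) (Fin.toℕ<n w)) f≤w)
    w∸f+f≡w : toℕ (fromℕ< w∸f<h) + f ≡ toℕ w
    w∸f+f≡w = trans (cong (_+ f) (Fin.toℕ-fromℕ< w∸f<h)) (m∸n+n≡m f≤w)

  original : Fin m → CVertex (complete n)
  original = inj₁ ∘ Fin.suc

  subdivision : Fin h → CVertex (complete n)
  subdivision = inj₂ ∘ edge

  dominatingSet : List (CVertex (complete n))
  dominatingSet = tabulate original ++ tabulate subdivision

  dominatingSet-unique : Unique dominatingSet
  dominatingSet-unique = Unique.++⁺
    (Unique.tabulate⁺ (Fin.suc-injective ∘ inj₁-injective))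
    (Unique.tabulate⁺ (edge-injective ∘ inj₂-injective))
    λ (v∈originals , v∈subdivisions) →
      original≢subdivision (∈-tabulate⁻ v∈originals) (∈-tabulate⁻ v∈subdivisions)
    where
    original≢subdivision : ∀ {v} → (∃ λ i → v ≡ original i) → ¬ (∃ λ k → v ≡ subdivision k)
    original≢subdivision (_ , refl) (_ , ())

  dominatingSet-totalDominating : IsTotalDominating (central (complete n)) dominatingSet
  dominatingSet-totalDominating (inj₁ w) with edges-cover w
  ... | k , w∈edge = inj₂ (edge k) , ∈-++⁺ʳ (tabulate original) (∈-tabulate⁺ k) , w∈edge
  dominatingSet-totalDominating (inj₂ ((_ , Fin.suc j) , _)) =
    inj₁ (Fin.suc j) , ∈-++⁺ˡ (∈-tabulate⁺ j) , inj₂ refl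

  length-dominatingSet : length dominatingSet ≡ m + h
  length-dominatingSet = trans (length-++ (tabulate original) {tabulate subdivision})
    (cong₂ _+_ (length-tabulate original) (length-tabulate subdivision))

lemma2p4 : ∀ (n : ℕ) → n ≥ 2 →
    TotalDominationNumber (central (complete n)) (n + (n + 1) / 2 ∸ 1)
lemma2p4 zero ()
lemma2p4 (suc zero) (s≤s ())
lemma2p4 (suc (suc p)) _ =
  subst (λ h → TotalDominationNumber (central (complete n)) (m + h)) (⌈n/2⌉≡[n+1]/2 n)
    ( (dominatingSet , dominatingSet-unique , dominatingSet-totalDominating , length-dominatingSet)
    , λ S _ → totalDominating-central-complete-≥ m S)
  where
  m = suc p
  n = suc m
  open ShiftedMatching m ⌈ n /2⌉ ⌊ n /2⌋ z<s
    (trans (+-comm ⌈ n /2⌉ ⌊ n /2⌋) (⌊n/2⌋+⌈n/2⌉≡n n)) (⌊n/2⌋≤⌈n/2⌉ n)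
    using (dominatingSet; dominatingSet-unique; dominatingSet-totalDominating; length-dominatingSet)
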